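{- If $G$ is a $3$-edge-connected graph of order $n$, then \[ \rho(G) \leq \begin{cases} \frac{n}{4} & \text{if } n\equiv 0 \pmod{4} \text{ or } n \equiv 1 \pmod{4}, \\ \frac{n}{4} - \frac{1}{2(n-1)} & \text{if } n \equiv 2 \pmod{4}, \\ \frac{n}{4} - \frac{3}{2(n-1)} & \text{if } n \equiv 3 \pmod{4}. \end{cases} \] This bound is sharp.
   Context: All graphs are finite, simple and connected. For a connected graph $G$ of order $n\ge 2$ and a vertex $v$, $\overline{\sigma}_G(v)=\frac{1}{n-1}\sum_{w\in V(G)} d_G(v,w)$; the remoteness is $\rho(G)=\max_{v}\overline{\sigma}_G(v)$. A graph is $3$-edge-connected if removing fewer than $3$ edges leaves it connected. -}

module Defs where

open import Data.Nat using (ℕ; zero; suc; _+_; _*_; _∸_; _<_; _≤_; _⊔_)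
open import Data.Nat.DivMod using (_%_)
open import Data.Fin using (Fin)
open import Data.Fin.Properties using ()
open import Data.List using (List; []; _∷_; length; map; foldr; allFin)
open import Data.Nat.ListAction using (sum)
open import Data.List.Membership.Propositional using (_∈_)
open import Data.Product using (_×_; _,_; Σ; ∃)
open import Data.Sum using (_⊎_)
open import Data.Integer using (+_)
open import Data.Rational.Unnormalised using (ℚᵘ; mkℚᵘ; _-_)
open import Relation.Nullary using (¬_)
open import Relation.Binary.PropositionalEquality using (_≡_)

record Graph (n : ℕ) : Set₁ where
  field
    Adj     : Fin n → Fin n → Set
    sym     : ∀ {u v} → Adj u v → Adj v u
    irrefl  : ∀ {u} → ¬ Adj u u
open Graph public

data Walk {n : ℕ} (A : Fin n → Fin n → Set) : Fin n → Fin n → ℕ → Set where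
  here : ∀ {u} → Walk A u u 0
  step : ∀ {u v w k} → A u v → Walk A v w k → Walk A u w (suc k)

Connected : {n : ℕ} → (Fin n → Fin n → Set) → Set
Connected {n} A = ∀ (u v : Fin n) → ∃ λ k → Walk A u v k

InEdges : {n : ℕ} → List (Fin n × Fin n) → Fin n → Fin n → Set
InEdges F u v = ((u , v) ∈ F) ⊎ ((v , u) ∈ F)

deleteEdges : {n : ℕ} → Graph n → List (Fin n × Fin n) → Fin n → Fin n → Set
deleteEdges G F u v = Adj G u v × ¬ InEdges F u v

-- k-edge-connected: removing fewer than k edges leaves the graph connected.
-- (Listing pairs that are not edges of G has no effect, so this is exactly
--  "removing any set of fewer than k edges".)
EdgeConnected : {n : ℕ} → ℕ → Graph n → Set
EdgeConnected k G = ∀ F → length F < k → Connected (deleteEdges G F)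

IsDist : {n : ℕ} → Graph n → Fin n → Fin n → ℕ → Set
IsDist G u v d = Walk (Adj G) u v d × (∀ m → Walk (Adj G) u v m → d ≤ m)

IsDistanceFunction : {n : ℕ} → Graph n → (Fin n → Fin n → ℕ) → Set
IsDistanceFunction {n} G D = ∀ (u v : Fin n) → IsDist G u v (D u v)

transmission : {n : ℕ} → (Fin n → Fin n → ℕ) → Fin n → ℕ
transmission {n} D v = sum (map (D v) (allFin n))

maxTransmission : {n : ℕ} → (Fin n → Fin n → ℕ) → ℕ
maxTransmission {n} D = foldr _⊔_ 0 (map (transmission D) (allFin n))

-- Remoteness ρ(G) = max_v σ(v)/(n-1)  (for n ≥ 2; mkℚᵘ p q denotes p/(q+1)).
remoteness : {n : ℕ} → (Fin n → Fin n → ℕ) → ℚᵘ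
remoteness {n} D = mkℚᵘ (+ maxTransmission D) (n ∸ 2)

boundCase : ℕ → ℕ → ℚᵘ
boundCase n 0 = mkℚᵘ (+ n) 3
boundCase n 1 = mkℚᵘ (+ n) 3
boundCase n 2 = mkℚᵘ (+ n) 3 - mkℚᵘ (+ 1) (2 * n ∸ 3)
boundCase n _ = mkℚᵘ (+ n) 3 - mkℚᵘ (+ 3) (2 * n ∸ 3)

remotenessBound : ℕ → ℚᵘ
remotenessBound n = boundCase n (n % 4)

DistFn : ℕ → Set
DistFn n = Fin n → Fin n → ℕ

-- Fix a vertex v and let m k be the number of vertices at distance at least k from v, so
-- that σ(v) = m 1 + m 2 + ⋯. If some vertex lies beyond distance k + 1, the edges between
-- the distance layers k and k + 1 separate it from v; with at most three vertices in these
-- two layers there are at most two such edges, so 3-edge-connectivity forces the two layers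
-- to hold at least four vertices, i.e. m (k + 2) ≤ m k − 4. Summing m 1 + m 2 + ⋯ two terms
-- at a time, starting from m 0 ≤ n and m 1 ≤ n − 1, gives 4 σ(v) ≤ n (n − 1) − δ(n), where
-- δ(n) = 0, 0, 2, 6 according to n mod 4; this is the bound.
--
-- Equality holds for n ≥ 4 on the graph whose vertices are arranged in levels of sizes
-- 1, 3, 1, 3, … (the last n mod 4 vertices sharing the top level), two vertices being adjacent
-- when their levels differ by at most one. Its levels are the distance layers of the level-0
-- vertex, whose transmission meets the bound exactly. Each vertex of positive level has three
-- edge-disjoint routes of length at most two to the level below, so deleting two edges cannot
-- cut it off from level 0.

module Submission where

open import Defs hiding (sym)
open import Data.Bool using (true; false; if_then_else_)
open import Data.Empty using (⊥-elim)
open import Data.Fin as Fin using (Fin; zero; suc; _↑ʳ_)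
open import Data.Fin.Properties using (↑ʳ-injective)
open import Data.List
  using (List; []; _∷_; length; map; filter; cartesianProduct; tabulate; allFin)
open import Data.List.Properties
  using (length-++; length-map; length-tabulate; map-cong; map-tabulate; tabulate-cong;
         foldr-preservesᵇ; foldr-preservesᵒ)
open import Data.List.Membership.Propositional using (_∈_; find)
open import Data.List.Membership.Propositional.Properties
  using (∈-allFin; ∈-filter⁺; ∈-cartesianProduct⁺; ∈-map⁺)
import Data.List.Membership.DecPropositional as DecMembership
open import Data.List.Relation.Unary.All using (All; []; _∷_)
open import Data.List.Relation.Unary.All.Properties using (¬Any⇒All¬; map⁺; tabulate⁺)
open import Data.List.Relation.Unary.Any using (Any; here; there; any?)
import Data.List.Relation.Unary.Any as Any
open import Data.Nat
open import Data.Nat.DivMod using (_%_; [m+n]%n≡m%n)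
open import Data.Nat.ListAction using (sum)
open import Data.Nat.Properties
open import Data.Nat.Tactic.RingSolver using (solve-∀)
open import Data.Product using (Σ; _×_; _,_; proj₁; proj₂; ∃; swap)
open import Data.Product.Properties using (≡-dec)
open import Data.Rational.Unnormalised using (ℚᵘ; mkℚᵘ) renaming (_≤_ to _≤ℚ_; _≃_ to _≃ℚ_)
open import Data.Sum using (_⊎_; inj₁; inj₂; [_,_]′)
import Data.Sum as Sum
open import Function using (_∘_; id)
open import Relation.Binary.PropositionalEquality
open import Relation.Nullary using (Dec; does; yes; no; ¬_)
open import Relation.Nullary.Decidable using (_⊎-dec_)
open import Relation.Unary using (Decidable)

∑ : {A : Set} → List A → (A → ℕ) → ℕ
∑ xs f = sum (map f xs)

𝟙 : {P : Set} → Dec P → ℕ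
𝟙 p = if does p then 1 else 0

module _ {A : Set} where

  ∑-cong : ∀ (xs : List A) {f g : A → ℕ} → (∀ x → f x ≡ g x) → ∑ xs f ≡ ∑ xs g
  ∑-cong xs f≗g = cong sum (map-cong f≗g xs)

  ∑-+ : ∀ (xs : List A) (f g : A → ℕ) → ∑ xs (λ x → f x + g x) ≡ ∑ xs f + ∑ xs g
  ∑-+ []       f g = refl
  ∑-+ (x ∷ xs) f g = begin
    f x + g x + ∑ xs (λ x → f x + g x)  ≡⟨ cong (f x + g x +_) (∑-+ xs f g) ⟩
    f x + g x + (∑ xs f + ∑ xs g)       ≡⟨ interchange (f x) (g x) (∑ xs f) (∑ xs g) ⟩
    f x + ∑ xs f + (g x + ∑ xs g)       ∎
    where
    open ≡-Reasoning
    interchange : ∀ a b c d → a + b + (c + d) ≡ a + c + (b + d)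
    interchange = solve-∀

  ∑-mono : ∀ (xs : List A) {f g : A → ℕ} → (∀ x → f x ≤ g x) → ∑ xs f ≤ ∑ xs g
  ∑-mono []       f≤g = z≤n
  ∑-mono (x ∷ xs) f≤g = +-mono-≤ (f≤g x) (∑-mono xs f≤g)

  ∈⇒≤∑ : ∀ (f : A → ℕ) {x xs} → x ∈ xs → f x ≤ ∑ xs f
  ∈⇒≤∑ f              (here refl) = m≤m+n _ _
  ∈⇒≤∑ f {xs = y ∷ _} (there x∈)  = ≤-trans (∈⇒≤∑ f x∈) (m≤n+m _ (f y))

  ∑-pos⇒∃ : ∀ (xs : List A) (f : A → ℕ) → 0 < ∑ xs f → ∃ λ x → 0 < f x
  ∑-pos⇒∃ (x ∷ xs) f pos with f x in fx
  ... | suc _ = x , subst (0 <_) (sym fx) (s≤s z≤n)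
  ... | zero  = ∑-pos⇒∃ xs f pos

  ∑≤length : ∀ (xs : List A) {f : A → ℕ} → (∀ x → f x ≤ 1) → ∑ xs f ≤ length xs
  ∑≤length []       f≤1 = z≤n
  ∑≤length (x ∷ xs) f≤1 = +-mono-≤ (f≤1 x) (∑≤length xs f≤1)

  ∑<length : ∀ {xs : List A} {f : A → ℕ} {x} → (∀ x → f x ≤ 1) → x ∈ xs → f x ≡ 0 →
             ∑ xs f < length xs
  ∑<length {_ ∷ xs}     f≤1 (here refl) fx≡0 rewrite fx≡0 = s≤s (∑≤length xs f≤1)
  ∑<length {y ∷ _} {f} f≤1 (there x∈)  fx≡0 =
    ≤-trans (≤-reflexive (sym (+-suc (f y) _))) (+-mono-≤ (f≤1 y) (∑<length f≤1 x∈ fx≡0))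

  length-filter≡∑ : ∀ {P : A → Set} (P? : Decidable P) xs → length (filter P? xs) ≡ ∑ xs (𝟙 ∘ P?)
  length-filter≡∑ P? []       = refl
  length-filter≡∑ P? (x ∷ xs) with does (P? x)
  ... | true  = cong suc (length-filter≡∑ P? xs)
  ... | false = length-filter≡∑ P? xs

length-cartesianProduct : ∀ {A B : Set} (xs : List A) (ys : List B) →
  length (cartesianProduct xs ys) ≡ length xs * length ys
length-cartesianProduct []       ys = refl
length-cartesianProduct (x ∷ xs) ys = trans (length-++ (map (x ,_) ys))
  (cong₂ _+_ (length-map (x ,_) ys) (length-cartesianProduct xs ys))

-- Layer-cake sums

atLeast : ℕ → ℕ → ℕ
atLeast zero    _       = 1
atLeast (suc k) zero    = 0
atLeast (suc k) (suc x) = atLeast k x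

atLeast≤1 : ∀ k x → atLeast k x ≤ 1
atLeast≤1 zero    x       = ≤-refl
atLeast≤1 (suc k) zero    = z≤n
atLeast≤1 (suc k) (suc x) = atLeast≤1 k x

atLeast-suc≤ : ∀ k x → atLeast (suc k) x ≤ atLeast k x
atLeast-suc≤ zero    x       = atLeast≤1 1 x
atLeast-suc≤ (suc k) zero    = z≤n
atLeast-suc≤ (suc k) (suc x) = atLeast-suc≤ k x

atLeast⇒≤ : ∀ k x → 0 < atLeast k x → k ≤ x
atLeast⇒≤ zero    x       _   = z≤n
atLeast⇒≤ (suc k) (suc x) pos = s≤s (atLeast⇒≤ k x pos)

atLeast-split : ∀ k x → atLeast k x ≡ atLeast (2 + k) x + (𝟙 (x ≟ k) + 𝟙 (x ≟ suc k))
atLeast-split zero    zero          = refl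
atLeast-split zero    (suc zero)    = refl
atLeast-split zero    (suc (suc x)) = refl
atLeast-split (suc k) zero          = refl
atLeast-split (suc k) (suc x)       = atLeast-split k x

pairSum : (ℕ → ℕ) → ℕ → ℕ
pairSum m zero    = 0
pairSum m (suc K) = m 1 + m 2 + pairSum (m ∘ (2 +_)) K

pairSum-vanishing : ∀ m K → (∀ k → m (suc k) ≡ 0) → pairSum m K ≡ 0
pairSum-vanishing m zero    m≡0 = refl
pairSum-vanishing m (suc K) m≡0
  rewrite m≡0 0 | m≡0 1 = pairSum-vanishing (m ∘ (2 +_)) K (m≡0 ∘ (2 +_))

pairSum-atLeast : ∀ K x → x ≤ K + K → pairSum (λ k → atLeast k x) K ≡ x
pairSum-atLeast zero    zero          _ = refl
pairSum-atLeast (suc K) zero          _ =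
  pairSum-vanishing (λ k → atLeast (2 + k) 0) K (λ _ → refl)
pairSum-atLeast (suc K) (suc zero)    _ =
  cong suc (pairSum-vanishing (λ k → atLeast (2 + k) 1) K (λ _ → refl))
pairSum-atLeast (suc K) (suc (suc x)) (s≤s x≤) =
  cong (2 +_) (pairSum-atLeast K x (≤-pred (≤-trans x≤ (≤-reflexive (+-suc K K)))))

pairSum-∑ : ∀ {A : Set} (xs : List A) (f : ℕ → A → ℕ) K →
  pairSum (λ k → ∑ xs (f k)) K ≡ ∑ xs (λ x → pairSum (λ k → f k x) K)
pairSum-∑ xs f zero    = sym (∑-zero xs)
  where
  ∑-zero : ∀ (xs : List _) → ∑ xs (λ _ → 0) ≡ 0
  ∑-zero []       = refl
  ∑-zero (_ ∷ xs) = ∑-zero xs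
pairSum-∑ xs f (suc K) = begin
  ∑ xs (f 1) + ∑ xs (f 2) + pairSum (λ k → ∑ xs (f (2 + k))) K
    ≡⟨ cong (∑ xs (f 1) + ∑ xs (f 2) +_) (pairSum-∑ xs (f ∘ (2 +_)) K) ⟩
  ∑ xs (f 1) + ∑ xs (f 2) + ∑ xs (λ x → pairSum (λ k → f (2 + k) x) K)
    ≡⟨ cong (_+ ∑ xs (λ x → pairSum (λ k → f (2 + k) x) K)) (∑-+ xs (f 1) (f 2)) ⟨
  ∑ xs (λ x → f 1 x + f 2 x) + ∑ xs (λ x → pairSum (λ k → f (2 + k) x) K)
    ≡⟨ ∑-+ xs _ _ ⟨
  ∑ xs (λ x → pairSum (λ k → f k x) (suc K)) ∎
  where open ≡-Reasoning

-- boundCase n r is (n (n − 1) − residueDefect r) / (4 (n − 1)).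
residueDefect : ℕ → ℕ
residueDefect 0 = 0
residueDefect 1 = 0
residueDefect 2 = 2
residueDefect _ = 6

defect : ℕ → ℕ
defect n = residueDefect (n % 4)

defect-4+ : ∀ a → defect (4 + a) ≡ defect a
defect-4+ a = cong residueDefect (trans (cong (_% 4) (+-comm 4 a)) ([m+n]%n≡m%n a 4))

defect≤ : ∀ a → defect a ≤ a * (a ∸ 1)
defect≤ 0 = z≤n
defect≤ 1 = z≤n
defect≤ 2 = ≤-refl
defect≤ 3 = ≤-refl
defect≤ (suc (suc (suc (suc b)))) =
  ≤-trans (residueDefect≤6 ((4 + b) % 4)) (*-mono-≤ {2} {4 + b} {3} (s≤s (s≤s z≤n)) (m≤m+n 3 b))
  where
  residueDefect≤6 : ∀ r → residueDefect r ≤ 6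
  residueDefect≤6 0                   = z≤n
  residueDefect≤6 1                   = z≤n
  residueDefect≤6 2                   = m≤m+n 2 4
  residueDefect≤6 (suc (suc (suc _))) = ≤-refl

square-step : ∀ b → (4 + b) * (4 + b ∸ 1) ≡ 4 * (3 + b) + 4 * b + b * (b ∸ 1)
square-step zero    = refl
square-step (suc b) = expand b
  where
  expand : ∀ b → (5 + b) * (4 + b) ≡ 4 * (4 + b) + 4 * (1 + b) + (1 + b) * b
  expand = solve-∀

module _ (m : ℕ → ℕ) (anti : ∀ k → m (suc k) ≤ m k)
         (gap : ∀ k → 0 < m (suc k) → 4 + m (2 + k) ≤ m k) where

  drop4 : ∀ k → m (2 + k) ≤ m k ∸ 4
  drop4 k with 0 <? m (suc k)
  ... | yes pos = m+n≤o⇒m≤o∸n _ (subst (_≤ m k) (+-comm 4 _) (gap k pos))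
  ... | no  ¬pos = ≤-trans (anti (suc k)) (≤-trans (≮⇒≥ ¬pos) z≤n)

  vanishes-from-1 : m 0 ≤ 3 → ∀ k → m (suc k) ≡ 0
  vanishes-from-1 m0≤3 k = n≤0⇒n≡0 (≤-trans (≤-m1 k) (≮⇒≥ ¬pos))
    where
    ≤-m1 : ∀ k → m (suc k) ≤ m 1
    ≤-m1 zero    = ≤-refl
    ≤-m1 (suc k) = ≤-trans (anti (suc k)) (≤-m1 k)
    ¬pos : ¬ 0 < m 1
    ¬pos pos = <⇒≱ (≤-trans (m≤m+n 4 (m 2)) (gap 0 pos)) m0≤3

pairSum-bound-few : ∀ K a (m : ℕ → ℕ) →
  (∀ k → m (suc k) ≤ m k) → (∀ k → 0 < m (suc k) → 4 + m (2 + k) ≤ m k) →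
  m 0 ≤ 3 → 4 * pairSum m K + defect a ≤ a * (a ∸ 1)
pairSum-bound-few K a m anti gap m0≤3
  rewrite pairSum-vanishing m K (vanishes-from-1 m anti gap m0≤3) = defect≤ a

pairSum-bound : ∀ K a (m : ℕ → ℕ) →
  (∀ k → m (suc k) ≤ m k) → (∀ k → 0 < m (suc k) → 4 + m (2 + k) ≤ m k) →
  m 0 ≤ a → m 1 ≤ a ∸ 1 → 4 * pairSum m K + defect a ≤ a * (a ∸ 1)
pairSum-bound zero    a m _ _ _ _ = defect≤ a
pairSum-bound (suc K) (suc (suc (suc (suc b)))) m anti gap m0≤ m1≤ = begin
  4 * (m 1 + m 2 + pairSum m′ K) + defect (4 + b)
    ≡⟨ cong (4 * (m 1 + m 2 + pairSum m′ K) +_) (defect-4+ b) ⟩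
  4 * (m 1 + m 2 + pairSum m′ K) + defect b
    ≡⟨ distrib (m 1) (m 2) (pairSum m′ K) (defect b) ⟩
  4 * m 1 + 4 * m 2 + (4 * pairSum m′ K + defect b)
    ≤⟨ +-mono-≤ (+-mono-≤ (*-monoʳ-≤ 4 m1≤) (*-monoʳ-≤ 4 m2≤)) rest-bound ⟩
  4 * (3 + b) + 4 * b + b * (b ∸ 1)
    ≡⟨ square-step b ⟨
  (4 + b) * (3 + b) ∎
  where
  open ≤-Reasoning
  m′ : ℕ → ℕ
  m′ = m ∘ (2 +_)
  m2≤ : m 2 ≤ b
  m2≤ = ≤-trans (drop4 m anti gap 0) (∸-monoˡ-≤ 4 m0≤)
  rest-bound : 4 * pairSum m′ K + defect b ≤ b * (b ∸ 1)
  rest-bound = pairSum-bound K b m′ (anti ∘ (2 +_)) (gap ∘ (2 +_)) m2≤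
    (≤-trans (drop4 m anti gap 1) (∸-monoˡ-≤ 4 m1≤))
  distrib : ∀ x y z c → 4 * (x + y + z) + c ≡ 4 * x + 4 * y + (4 * z + c)
  distrib = solve-∀
pairSum-bound (suc K) 0 m anti gap m0≤ _ = pairSum-bound-few (suc K) 0 m anti gap (≤-trans m0≤ z≤n)
pairSum-bound (suc K) 1 m anti gap m0≤ _ = pairSum-bound-few (suc K) 1 m anti gap (≤-trans m0≤ (m≤m+n 1 2))
pairSum-bound (suc K) 2 m anti gap m0≤ _ = pairSum-bound-few (suc K) 2 m anti gap (≤-trans m0≤ (m≤m+n 2 1))
pairSum-bound (suc K) 3 m anti gap m0≤ _ = pairSum-bound-few (suc K) 3 m anti gap m0≤

-- Clearing denominators

-- Integer +_ is kept local: at top level it makes ℕ sections such as (a +_) ambiguous.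
module _ where

  open import Data.Integer as ℤ using (+_)
  open import Data.Integer.Properties using (pos-+; pos-*; i≤i+j)
  import Data.Integer.Properties as ℤₚ
  import Data.Integer.Tactic.RingSolver as ℤ-Solver
  open import Data.Rational.Unnormalised using (*≤*; *≡*; ↥_; ↧_) renaming (_-_ to _-ℚ_)

  cross-slack⇒≤ : ∀ {p q : ℚᵘ} t → ↥ q ℤ.* ↧ p ≡ ↥ p ℤ.* ↧ q ℤ.+ + t → p ≤ℚ q
  cross-slack⇒≤ {p} {q} t eq = *≤* (subst (↥ p ℤ.* ↧ q ℤ.≤_) (sym eq) (i≤i+j (↥ p ℤ.* ↧ q) (+ t)))

  cross-exact⇒≃ : ∀ {p q : ℚᵘ} → ↥ q ℤ.* ↧ p ≡ ↥ p ℤ.* ↧ q ℤ.+ + 0 → p ≃ℚ q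
  cross-exact⇒≃ eq = *≡* (sym (trans eq (ℤₚ.+-identityʳ _)))

  NK≡4M+2c+s-in-ℤ : ∀ N K M c s → 4 * M + 2 * c + s ≡ N * K →
    + N ℤ.* + K ≡ + 4 ℤ.* + M ℤ.+ + 2 ℤ.* + c ℤ.+ + s
  NK≡4M+2c+s-in-ℤ N K M c s h = begin
    + N ℤ.* + K                          ≡⟨ pos-* N K ⟨
    + (N * K)                            ≡⟨ cong +_ h ⟨
    + (4 * M + 2 * c + s)                ≡⟨ pos-+ (4 * M + 2 * c) s ⟩
    + (4 * M + 2 * c) ℤ.+ + s            ≡⟨ cong (ℤ._+ + s) (pos-+ (4 * M) (2 * c)) ⟩
    + (4 * M) ℤ.+ + (2 * c) ℤ.+ + s      ≡⟨ cong₂ (λ a b → a ℤ.+ b ℤ.+ + s) (pos-* 4 M) (pos-* 2 c) ⟩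
    + 4 ℤ.* + M ℤ.+ + 2 ℤ.* + c ℤ.+ + s  ∎
    where open ≡-Reasoning

  quarter-cross : ∀ k M s → 4 * M + 0 + s ≡ (2 + k) * (1 + k) →
    ↥ mkℚᵘ (+ (2 + k)) 3 ℤ.* ↧ mkℚᵘ (+ M) k ≡ ↥ mkℚᵘ (+ M) k ℤ.* ↧ mkℚᵘ (+ (2 + k)) 3 ℤ.+ + s
  quarter-cross k M s h = trans (NK≡4M+2c+s-in-ℤ (2 + k) (1 + k) M 0 s h) (reorder (+ M) (+ s))
    where
    reorder : ∀ M s → + 4 ℤ.* M ℤ.+ + 2 ℤ.* + 0 ℤ.+ s ≡ M ℤ.* + 4 ℤ.+ s
    reorder = ℤ-Solver.solve-∀

  -- The slack is written s * 2(n − 1), not 2(n − 1) * s, so that it is definitionally 0 at s = 0.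
  quarter-minus-cross : ∀ k c M s → 4 * M + 2 * c + s ≡ (2 + k) * (1 + k) →
    let q = mkℚᵘ (+ (2 + k)) 3 -ℚ mkℚᵘ (+ c) (2 * (2 + k) ∸ 3) in
    ↥ q ℤ.* ↧ mkℚᵘ (+ M) k ≡ ↥ mkℚᵘ (+ M) k ℤ.* ↧ q ℤ.+ + (s * (2 * (1 + k)))
  quarter-minus-cross k c M s h = begin
    (+ N ℤ.* + suc t ℤ.+ ℤ.- + c ℤ.* + 4) ℤ.* + K
      ≡⟨ cong (λ x → (+ N ℤ.* x ℤ.+ ℤ.- + c ℤ.* + 4) ℤ.* + K) [1+t]≡2K ⟩
    (+ N ℤ.* (+ 2 ℤ.* + K) ℤ.+ ℤ.- + c ℤ.* + 4) ℤ.* + K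
      ≡⟨ expand (+ N) (+ K) (+ c) ⟩
    + 2 ℤ.* + K ℤ.* (+ N ℤ.* + K) ℤ.- + 4 ℤ.* + c ℤ.* + K
      ≡⟨ cong (λ x → + 2 ℤ.* + K ℤ.* x ℤ.- + 4 ℤ.* + c ℤ.* + K) (NK≡4M+2c+s-in-ℤ N K M c s h) ⟩
    + 2 ℤ.* + K ℤ.* (+ 4 ℤ.* + M ℤ.+ + 2 ℤ.* + c ℤ.+ + s) ℤ.- + 4 ℤ.* + c ℤ.* + K
      ≡⟨ collect (+ M) (+ K) (+ c) (+ s) ⟩
    + M ℤ.* (+ 4 ℤ.* (+ 2 ℤ.* + K)) ℤ.+ + s ℤ.* (+ 2 ℤ.* + K)
      ≡⟨ cong₂ (λ x y → + M ℤ.* x ℤ.+ y)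
               (sym (trans (pos-* 4 (suc t)) (cong (+ 4 ℤ.*_) [1+t]≡2K)))
               (sym (trans (pos-* s (2 * K)) (cong (+ s ℤ.*_) (pos-* 2 K)))) ⟩
    + M ℤ.* + (4 * suc t) ℤ.+ + (s * (2 * K)) ∎
    where
    open ≡-Reasoning
    N K t : ℕ
    N = 2 + k
    K = 1 + k
    t = 2 * N ∸ 3
    [1+t]≡2K : + suc t ≡ + 2 ℤ.* + K
    [1+t]≡2K = trans (cong +_ (1+t≡2K k)) (pos-* 2 K)
      where
      1+t≡2K : ∀ k → suc (2 * (2 + k) ∸ 3) ≡ 2 * (1 + k)
      1+t≡2K k rewrite +-suc k (suc (k + 0)) | +-suc k (k + 0) = refl
    expand : ∀ N K c →
      (N ℤ.* (+ 2 ℤ.* K) ℤ.+ ℤ.- c ℤ.* + 4) ℤ.* K ≡ + 2 ℤ.* K ℤ.* (N ℤ.* K) ℤ.- + 4 ℤ.* c ℤ.* K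
    expand = ℤ-Solver.solve-∀
    collect : ∀ M K c s →
      + 2 ℤ.* K ℤ.* (+ 4 ℤ.* M ℤ.+ + 2 ℤ.* c ℤ.+ s) ℤ.- + 4 ℤ.* c ℤ.* K ≡
      M ℤ.* (+ 4 ℤ.* (+ 2 ℤ.* K)) ℤ.+ s ℤ.* (+ 2 ℤ.* K)
    collect = ℤ-Solver.solve-∀

  ratio-vs-boundCase : ∀ k r M s → 4 * M + residueDefect r + s ≡ (2 + k) * (1 + k) →
    mkℚᵘ (+ M) k ≤ℚ boundCase (2 + k) r × (s ≡ 0 → mkℚᵘ (+ M) k ≃ℚ boundCase (2 + k) r)
  ratio-vs-boundCase k 0 M s h =
    cross-slack⇒≤ s (quarter-cross k M s h) ,
    λ { refl → cross-exact⇒≃ (quarter-cross k M 0 h) }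
  ratio-vs-boundCase k 1 M s h =
    cross-slack⇒≤ s (quarter-cross k M s h) ,
    λ { refl → cross-exact⇒≃ (quarter-cross k M 0 h) }
  ratio-vs-boundCase k 2 M s h =
    cross-slack⇒≤ _ (quarter-minus-cross k 1 M s h) ,
    λ { refl → cross-exact⇒≃ (quarter-minus-cross k 1 M 0 h) }
  ratio-vs-boundCase k (suc (suc (suc _))) M s h =
    cross-slack⇒≤ _ (quarter-minus-cross k 3 M s h) ,
    λ { refl → cross-exact⇒≃ (quarter-minus-cross k 3 M 0 h) }

  remoteness≤bound : ∀ n M → 2 ≤ n → 4 * M + defect n ≤ n * (n ∸ 1) →
    mkℚᵘ (+ M) (n ∸ 2) ≤ℚ remotenessBound n
  remoteness≤bound (suc (suc k)) M (s≤s (s≤s _)) le =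
    proj₁ (ratio-vs-boundCase k ((2 + k) % 4) M _ (proj₂ (m≤n⇒∃[o]m+o≡n le)))

  remoteness≃bound : ∀ n M → 2 ≤ n → 4 * M + defect n ≡ n * (n ∸ 1) →
    mkℚᵘ (+ M) (n ∸ 2) ≃ℚ remotenessBound n
  remoteness≃bound (suc (suc k)) M (s≤s (s≤s _)) eq =
    proj₂ (ratio-vs-boundCase k ((2 + k) % 4) M 0 (trans (+-identityʳ _) eq)) refl

-- Transmissions in 3-edge-connected graphs

module _ {n : ℕ} {A : Fin n → Fin n → Set} where

  _▷_ : ∀ {u v w k} → Walk A u v k → A v w → Walk A u w (suc k)
  here     ▷ e′ = step e′ here
  step e p ▷ e′ = step e (p ▷ e′)

  _++ʷ_ : ∀ {u v w k l} → Walk A u v k → Walk A v w l → Walk A u w (k + l)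
  here     ++ʷ q = q
  step e p ++ʷ q = step e (p ++ʷ q)

  reverseʷ : (∀ {a b} → A a b → A b a) → ∀ {u v k} → Walk A u v k → Walk A v u k
  reverseʷ sym here       = here
  reverseʷ sym (step e p) = reverseʷ sym p ▷ sym e

product≤2 : ∀ a b → a + b ≤ 3 → a * b ≤ 2
product≤2 0 b _ = z≤n
product≤2 1 b h = ≤-trans (≤-reflexive (+-identityʳ b)) (≤-pred h)
product≤2 2 0 _ = z≤n
product≤2 2 1 _ = ≤-refl
product≤2 3 0 _ = z≤n
product≤2 2 (suc (suc b)) (s≤s (s≤s (s≤s ())))
product≤2 3 (suc b)       (s≤s (s≤s (s≤s ())))
product≤2 (suc (suc (suc (suc a)))) b (s≤s (s≤s (s≤s ())))

module TransmissionBound {n : ℕ} (G : Graph n) (ec : EdgeConnected 3 G)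
                         {D : DistFn n} (isDist : IsDistanceFunction G D) (v : Fin n) where

  d : Fin n → ℕ
  d = D v

  d-self : d v ≡ 0
  d-self = n≤0⇒n≡0 (proj₂ (isDist v v) 0 here)

  d-edge : ∀ {a b} → Adj G a b → d b ≤ suc (d a)
  d-edge {a} ab = proj₂ (isDist v _) _ (proj₁ (isDist v a) ▷ ab)

  layer : ℕ → List (Fin n)
  layer k = filter (λ w → d w ≟ k) (allFin n)

  count≥ : ℕ → ℕ
  count≥ k = ∑ (allFin n) (λ w → atLeast k (d w))

  count≥-anti : ∀ k → count≥ (suc k) ≤ count≥ k
  count≥-anti k = ∑-mono (allFin n) (λ w → atLeast-suc≤ k (d w))

  count≥-split : ∀ k → count≥ k ≡ count≥ (2 + k) + (length (layer k) + length (layer (suc k)))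
  count≥-split k = begin
    count≥ k
      ≡⟨ ∑-cong (allFin n) (λ w → atLeast-split k (d w)) ⟩
    ∑ (allFin n) (λ w → atLeast (2 + k) (d w) + (𝟙 (d w ≟ k) + 𝟙 (d w ≟ suc k)))
      ≡⟨ ∑-+ (allFin n) _ _ ⟩
    count≥ (2 + k) + ∑ (allFin n) (λ w → 𝟙 (d w ≟ k) + 𝟙 (d w ≟ suc k))
      ≡⟨ cong (count≥ (2 + k) +_) (∑-+ (allFin n) _ _) ⟩
    count≥ (2 + k) + (∑ (allFin n) (λ w → 𝟙 (d w ≟ k)) + ∑ (allFin n) (λ w → 𝟙 (d w ≟ suc k)))
      ≡⟨ cong (count≥ (2 + k) +_)
              (cong₂ _+_ (length-filter≡∑ _ (allFin n)) (length-filter≡∑ _ (allFin n))) ⟨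
    count≥ (2 + k) + (length (layer k) + length (layer (suc k))) ∎
    where open ≡-Reasoning

  stays-within : ∀ k F → (∀ {a b} → d a ≡ k → d b ≡ suc k → (a , b) ∈ F) →
                 ∀ {u w l} → Walk (deleteEdges G F) u w l → d u ≤ k → d w ≤ k
  stays-within k F F∋ here du≤k = du≤k
  stays-within k F F∋ (step {u = u} {v = x} (ux , ux∉F) rest) du≤k with d x ≤? k
  ... | yes dx≤k = stays-within k F F∋ rest dx≤k
  ... | no  dx≰k = ⊥-elim (ux∉F (inj₁ (F∋ du≡k dx≡1+k)))
    where
    dx≡1+k : d x ≡ suc k
    dx≡1+k = ≤-antisym (≤-trans (d-edge ux) (s≤s du≤k)) (≰⇒> dx≰k)
    du≡k : d u ≡ k
    du≡k = ≤-antisym du≤k (≤-pred (≤-trans (≰⇒> dx≰k) (d-edge ux)))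

  -- The edges between layers k and k + 1 separate v from any vertex farther than k.
  layers-meet-4 : ∀ k → 0 < count≥ (suc k) → 4 ≤ length (layer k) + length (layer (suc k))
  layers-meet-4 k far with ∑-pos⇒∃ (allFin n) (λ w → atLeast (suc k) (d w)) far
                         | 4 ≤? length (layer k) + length (layer (suc k))
  ... | _         | yes enough = enough
  ... | w , w-far | no  few    =
    ⊥-elim (<⇒≱ (atLeast⇒≤ (suc k) (d w) w-far) (stays-within k F F∋ (proj₂ (ec F |F|<3 v w)) v-inside))
    where
    F : List (Fin n × Fin n)
    F = cartesianProduct (layer k) (layer (suc k))
    F∋ : ∀ {a b} → d a ≡ k → d b ≡ suc k → (a , b) ∈ F
    F∋ {a} {b} da db = ∈-cartesianProduct⁺ (∈-filter⁺ _ (∈-allFin a) da) (∈-filter⁺ _ (∈-allFin b) db)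
    |F|<3 : length F < 3
    |F|<3 = s≤s (≤-trans (≤-reflexive (length-cartesianProduct (layer k) (layer (suc k))))
                         (product≤2 (length (layer k)) (length (layer (suc k))) (≤-pred (≰⇒> few))))
    v-inside : d v ≤ k
    v-inside = subst (_≤ k) (sym d-self) z≤n

  count≥-gap : ∀ k → 0 < count≥ (suc k) → 4 + count≥ (2 + k) ≤ count≥ k
  count≥-gap k far = begin
    4 + count≥ (2 + k)                                            ≤⟨ +-monoˡ-≤ _ (layers-meet-4 k far) ⟩
    length (layer k) + length (layer (suc k)) + count≥ (2 + k)   ≡⟨ +-comm _ (count≥ (2 + k)) ⟩
    count≥ (2 + k) + (length (layer k) + length (layer (suc k))) ≡⟨ count≥-split k ⟨
    count≥ k                                                      ∎
    where open ≤-Reasoning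

  count≥-0 : count≥ 0 ≤ n
  count≥-0 = ≤-trans (∑≤length (allFin n) (λ w → atLeast≤1 0 (d w))) (≤-reflexive (length-tabulate id))

  count≥-1 : count≥ 1 ≤ n ∸ 1
  count≥-1 = m+n≤o⇒m≤o∸n (count≥ 1) (subst (_≤ n) (+-comm 1 (count≥ 1)) (≤-trans
    (∑<length (λ w → atLeast≤1 1 (d w)) (∈-allFin v) (cong (atLeast 1) d-self))
    (≤-reflexive (length-tabulate id))))

  transmission≡pairSum : transmission D v ≡ pairSum count≥ (transmission D v)
  transmission≡pairSum = begin
    ∑ (allFin n) d
      ≡⟨ ∑-cong (allFin n) (λ w → sym (pairSum-atLeast σ (d w) (≤-trans (∈⇒≤∑ d (∈-allFin w)) (m≤m+n σ σ)))) ⟩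
    ∑ (allFin n) (λ w → pairSum (λ k → atLeast k (d w)) σ)
      ≡⟨ pairSum-∑ (allFin n) (λ k w → atLeast k (d w)) σ ⟨
    pairSum count≥ σ ∎
    where
    open ≡-Reasoning
    σ = transmission D v

  transmission-bound : 4 * transmission D v + defect n ≤ n * (n ∸ 1)
  transmission-bound = subst (λ σ → 4 * σ + defect n ≤ n * (n ∸ 1)) (sym transmission≡pairSum)
    (pairSum-bound (transmission D v) n count≥ count≥-anti count≥-gap count≥-0 count≥-1)

⊔-preserves : (P : ℕ → Set) → ∀ {x y} → P x → P y → P (x ⊔ y)
⊔-preserves P {x} {y} px py = [ (λ eq → subst P (sym eq) px) , (λ eq → subst P (sym eq) py) ]′ (⊔-sel x y)

maxTransmission-bound : ∀ {n} (G : Graph n) → EdgeConnected 3 G → {D : DistFn n} →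
  IsDistanceFunction G D → 4 * maxTransmission D + defect n ≤ n * (n ∸ 1)
maxTransmission-bound {n} G ec isDist =
  foldr-preservesᵇ {P = Admissible} (λ {x y} → ⊔-preserves Admissible {x} {y})
    (defect≤ n) (map⁺ (tabulate⁺ (TransmissionBound.transmission-bound G ec isDist)))
  where
  Admissible : ℕ → Set
  Admissible σ = 4 * σ + defect n ≤ n * (n ∸ 1)

transmission≤max : ∀ {n} (D : DistFn n) v → transmission D v ≤ maxTransmission D
transmission≤max {n} D v =
  foldr-preservesᵒ ≤-⊔ 0 _ (inj₂ (Any.map ≤-reflexive (∈-map⁺ (transmission D) (∈-allFin v))))
  where
  ≤-⊔ : ∀ x y → transmission D v ≤ x ⊎ transmission D v ≤ y → transmission D v ≤ x ⊔ y
  ≤-⊔ x y (inj₁ le) = ≤-trans le (m≤m⊔n x y)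
  ≤-⊔ x y (inj₂ le) = ≤-trans le (m≤n⊔m x y)

-- Edge-disjoint escape routes

pigeonhole-3-into-2 : ∀ {A : Set} {P Q R : A → Set} (F : List A) → length F < 3 →
  Any P F → Any Q F → Any R F →
  (∃ λ f → P f × Q f) ⊎ (∃ λ f → P f × R f) ⊎ (∃ λ f → Q f × R f)
pigeonhole-3-into-2 (f ∷ [])     _ (here p)         (here q)         _                = inj₁ (f , p , q)
pigeonhole-3-into-2 (f ∷ g ∷ []) _ (here p)         (here q)         _                = inj₁ (f , p , q)
pigeonhole-3-into-2 (f ∷ g ∷ []) _ (here p)         (there (here q)) (here r)         = inj₂ (inj₁ (f , p , r))
pigeonhole-3-into-2 (f ∷ g ∷ []) _ (here p)         (there (here q)) (there (here r)) = inj₂ (inj₂ (g , q , r))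
pigeonhole-3-into-2 (f ∷ g ∷ []) _ (there (here p)) (here q)         (here r)         = inj₂ (inj₂ (f , q , r))
pigeonhole-3-into-2 (f ∷ g ∷ []) _ (there (here p)) (here q)         (there (here r)) = inj₂ (inj₁ (g , p , r))
pigeonhole-3-into-2 (f ∷ g ∷ []) _ (there (here p)) (there (here q)) _                = inj₁ (g , p , q)
pigeonhole-3-into-2 (_ ∷ _ ∷ _ ∷ _) (s≤s (s≤s (s≤s ()))) _ _ _

module _ {n : ℕ} where

  Edge : Set
  Edge = Fin n × Fin n

  _≈ᵉ_ : Edge → Edge → Set
  e ≈ᵉ f = e ≡ f ⊎ e ≡ swap f

  ≈ᵉ-common : ∀ {e e′ f} → e ≈ᵉ f → e′ ≈ᵉ f → e ≈ᵉ e′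
  ≈ᵉ-common (inj₁ refl) (inj₁ refl) = inj₁ refl
  ≈ᵉ-common (inj₁ refl) (inj₂ refl) = inj₂ refl
  ≈ᵉ-common (inj₂ refl) (inj₁ refl) = inj₂ refl
  ≈ᵉ-common (inj₂ refl) (inj₂ refl) = inj₁ refl

  ≉ᵉ-by-source : ∀ {e f : Edge} → proj₁ e ≢ proj₁ f → proj₁ e ≢ proj₂ f → ¬ e ≈ᵉ f
  ≉ᵉ-by-source ≢₁ ≢₂ (inj₁ eq) = ≢₁ (cong proj₁ eq)
  ≉ᵉ-by-source ≢₁ ≢₂ (inj₂ eq) = ≢₂ (cong proj₁ eq)

  ≉ᵉ-by-target : ∀ {e f : Edge} → proj₂ e ≢ proj₂ f → proj₂ e ≢ proj₁ f → ¬ e ≈ᵉ f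
  ≉ᵉ-by-target ≢₂ ≢₁ (inj₁ eq) = ≢₂ (cong proj₂ eq)
  ≉ᵉ-by-target ≢₂ ≢₁ (inj₂ eq) = ≢₁ (cong proj₂ eq)

  EdgeDisjoint : List Edge → List Edge → Set
  EdgeDisjoint es fs = ∀ {e f} → e ∈ es → f ∈ fs → ¬ e ≈ᵉ f

  Deleted : List Edge → Edge → Set
  Deleted F (u , v) = InEdges F u v

  Avoids : List Edge → List Edge → Set
  Avoids F es = All (λ e → ¬ Deleted F e) es

  deleted⇒≈ᵉ-entry : ∀ {F e} → Deleted F e → Any (e ≈ᵉ_) F
  deleted⇒≈ᵉ-entry (inj₁ e∈F)     = Any.map inj₁ e∈F
  deleted⇒≈ᵉ-entry (inj₂ swape∈F) = Any.map (inj₂ ∘ cong swap) swape∈F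

  deleted? : ∀ F e → Dec (Deleted F e)
  deleted? F (u , v) = ((u , v) ∈? F) ⊎-dec ((v , u) ∈? F)
    where open DecMembership (≡-dec Fin._≟_ Fin._≟_)

  avoids-or-hits : ∀ F es → Avoids F es ⊎ ∃ λ e → e ∈ es × Deleted F e
  avoids-or-hits F es with any? (deleted? F) es
  ... | yes hit  = inj₂ (find hit)
  ... | no  miss = inj₁ (¬Any⇒All¬ es miss)

  one-of-three-avoids : ∀ F → length F < 3 → ∀ {es₁ es₂ es₃} →
    EdgeDisjoint es₁ es₂ → EdgeDisjoint es₁ es₃ → EdgeDisjoint es₂ es₃ →
    Avoids F es₁ ⊎ Avoids F es₂ ⊎ Avoids F es₃
  one-of-three-avoids F |F|<3 {es₁} {es₂} {es₃} d₁₂ d₁₃ d₂₃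
    with avoids-or-hits F es₁ | avoids-or-hits F es₂ | avoids-or-hits F es₃
  ... | inj₁ a₁ | _       | _       = inj₁ a₁
  ... | inj₂ _  | inj₁ a₂ | _       = inj₂ (inj₁ a₂)
  ... | inj₂ _  | inj₂ _  | inj₁ a₃ = inj₂ (inj₂ a₃)
  ... | inj₂ (_ , ∈₁ , del₁) | inj₂ (_ , ∈₂ , del₂) | inj₂ (_ , ∈₃ , del₃)
    with pigeonhole-3-into-2 F |F|<3 (deleted⇒≈ᵉ-entry del₁) (deleted⇒≈ᵉ-entry del₂) (deleted⇒≈ᵉ-entry del₃)
  ... | inj₁ (_ , p , q)        = ⊥-elim (d₁₂ ∈₁ ∈₂ (≈ᵉ-common p q))
  ... | inj₂ (inj₁ (_ , p , r)) = ⊥-elim (d₁₃ ∈₁ ∈₃ (≈ᵉ-common p r))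
  ... | inj₂ (inj₂ (_ , q , r)) = ⊥-elim (d₂₃ ∈₂ ∈₃ (≈ᵉ-common q r))

  edges : ∀ {A : Fin n → Fin n → Set} {u v k} → Walk A u v k → List Edge
  edges here                       = []
  edges (step {u = u} {v = v} _ p) = (u , v) ∷ edges p

  survives : ∀ (G : Graph n) F {u v k} (p : Walk (Adj G) u v k) → Avoids F (edges p) →
             Walk (deleteEdges G F) u v k
  survives G F here       []           = here
  survives G F (step e p) (e∉F ∷ rest) = step (e , e∉F) (survives G F p rest)

  deleteEdges-sym : ∀ (G : Graph n) F {a b} → deleteEdges G F a b → deleteEdges G F b a
  deleteEdges-sym G F (ab , ab∉F) = Graph.sym G ab , ab∉F ∘ Sum.swap

  record Escape (G : Graph n) (ℓ : Fin n → ℕ) (u : Fin n) (l : ℕ) : Set where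
    constructor escape
    field
      {end}  : Fin n
      {size} : ℕ
      route  : Walk (Adj G) u end size
      lands  : ℓ end ≡ l

  open Escape

  record ThreeEscapes (G : Graph n) (ℓ : Fin n → ℕ) (u : Fin n) (l : ℕ) : Set where
    field
      first second third : Escape G ℓ u l
      disjoint₁₂ : EdgeDisjoint (edges (route first))  (edges (route second))
      disjoint₁₃ : EdgeDisjoint (edges (route first))  (edges (route third))
      disjoint₂₃ : EdgeDisjoint (edges (route second)) (edges (route third))

  module _ (G : Graph n) (ℓ : Fin n → ℕ) (root : Fin n)
           (only-root-at-0 : ∀ u → ℓ u ≡ 0 → u ≡ root)
           (three-escapes : ∀ u l → ℓ u ≡ suc l → ThreeEscapes G ℓ u l) where

    escape-survives : ∀ F → length F < 3 → ∀ {u l} → ThreeEscapes G ℓ u l →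
                      ∃ λ y → ℓ y ≡ l × ∃ (Walk (deleteEdges G F) u y)
    escape-survives F |F|<3 {u} {l} t =
      [ survivor first , [ survivor second , survivor third ]′ ]′
        (one-of-three-avoids F |F|<3 disjoint₁₂ disjoint₁₃ disjoint₂₃)
      where
      open ThreeEscapes t
      survivor : (e : Escape G ℓ u l) → Avoids F (edges (route e)) →
                 ∃ λ y → ℓ y ≡ l × ∃ (Walk (deleteEdges G F) u y)
      survivor e avoids = end e , lands e , size e , survives G F (route e) avoids

    reaches-root : ∀ F → length F < 3 → ∀ l u → ℓ u ≡ l → ∃ (Walk (deleteEdges G F) u root)
    reaches-root F |F|<3 zero    u ℓu≡0 rewrite only-root-at-0 u ℓu≡0 = 0 , here
    reaches-root F |F|<3 (suc l) u ℓu≡1+l with escape-survives F |F|<3 (three-escapes u l ℓu≡1+l)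
    ... | y , ℓy≡l , k , u→y with reaches-root F |F|<3 l y ℓy≡l
    ...   | k′ , y→root = k + k′ , u→y ++ʷ y→root

    three-escapes⇒3-edge-connected : EdgeConnected 3 G
    three-escapes⇒3-edge-connected F |F|<3 u v
      with reaches-root F |F|<3 (ℓ u) u refl | reaches-root F |F|<3 (ℓ v) v refl
    ... | k , u→root | k′ , v→root = k + k′ , u→root ++ʷ reverseʷ (deleteEdges-sym G F) v→root

-- Layered graphs

∣m+n-n∣≡m : ∀ m n → ∣ m + n - n ∣ ≡ m
∣m+n-n∣≡m m n = trans (∣-∣-comm (m + n) n) (trans (cong (∣ n -_∣) (+-comm m n)) (∣m-m+n∣≡n n m))

module LayeredGraph {n : ℕ} (ℓ : Fin n → ℕ) where

  Near : Fin n → Fin n → Set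
  Near x y = x ≢ y × ∣ ℓ x - ℓ y ∣ ≤ 1

  layered : Graph n
  layered = record
    { Adj    = Near
    ; sym    = λ {x} {y} (x≢y , near) → x≢y ∘ sym , subst (_≤ 1) (∣-∣-comm (ℓ x) (ℓ y)) near
    ; irrefl = λ (x≢x , _) → x≢x refl
    }

  dist : DistFn n
  dist x y = if does (x Fin.≟ y) then 0 else 1 ⊔ ∣ ℓ x - ℓ y ∣

  layer-change≤length : ∀ {x y k} → Walk Near x y k → ∣ ℓ x - ℓ y ∣ ≤ k
  layer-change≤length {x} here = ≤-reflexive (∣n-n∣≡0 (ℓ x))
  layer-change≤length {x} {y} (step {v = z} (_ , near) rest) =
    ≤-trans (∣-∣-triangle (ℓ x) (ℓ z) (ℓ y)) (+-mono-≤ near (layer-change≤length rest))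

  dist≤length : ∀ {x y k} → Walk Near x y k → dist x y ≤ k
  dist≤length {x} {y} w with x Fin.≟ y
  dist≤length          w          | yes _   = z≤n
  dist≤length          here       | no  x≢x = ⊥-elim (x≢x refl)
  dist≤length          (step e w) | no  _   = ⊔-lub (s≤s z≤n) (layer-change≤length (step e w))

  layer≢⇒≢ : ∀ {x y} → ℓ x ≢ ℓ y → x ≢ y
  layer≢⇒≢ ℓx≢ℓy = ℓx≢ℓy ∘ cong ℓ

  lower⇒≢ : ∀ {x y l} → ℓ x ≡ l → ℓ y ≡ suc l → x ≢ y
  lower⇒≢ ℓx≡l ℓy≡1+l = layer≢⇒≢ (λ eq → 1+n≢n (trans (sym ℓy≡1+l) (trans (sym eq) ℓx≡l)))

  near-below : ∀ {x y} → ℓ x ≡ suc (ℓ y) → Near x y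
  near-below {x} {y} ℓx≡ = lower⇒≢ refl ℓx≡ ∘ sym ,
    ≤-reflexive (trans (cong (∣_- ℓ y ∣) ℓx≡) (∣m+n-n∣≡m 1 (ℓ y)))

  near-level : ∀ {x y} → x ≢ y → ℓ x ≡ ℓ y → Near x y
  near-level {x} {y} x≢y ℓx≡ℓy =
    x≢y , ≤-trans (≤-reflexive (trans (cong (∣_- ℓ y ∣) ℓx≡ℓy) (∣n-n∣≡0 (ℓ y)))) z≤n

  module _ (lower-levels-inhabited : ∀ x k → k ≤ ℓ x → ∃ λ z → ℓ z ≡ k) where

    descend : ∀ j x y → ℓ x ≡ j + ℓ y → x ≢ y → Walk Near x y (1 ⊔ j)
    descend zero          x y ℓx≡ x≢y = step (near-level x≢y ℓx≡) here
    descend (suc zero)    x y ℓx≡ _   = step (near-below ℓx≡) here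
    descend (suc (suc j)) x y ℓx≡ _   =
      step (near-below (trans ℓx≡ (cong suc (sym ℓz≡)))) (descend (suc j) z y ℓz≡ z≢y)
      where
      stone : ∃ λ z → ℓ z ≡ suc j + ℓ y
      stone = lower-levels-inhabited x (suc j + ℓ y) (≤-trans (n≤1+n _) (≤-reflexive (sym ℓx≡)))
      z = proj₁ stone
      ℓz≡ = proj₂ stone
      z≢y : z ≢ y
      z≢y = layer≢⇒≢ (λ eq → m≢1+n+m (ℓ y) (trans (sym eq) ℓz≡))

    dist-walk : ∀ x y → Walk Near x y (dist x y)
    dist-walk x y with x Fin.≟ y
    ... | yes refl = here
    ... | no  x≢y with ≤-total (ℓ y) (ℓ x)
    ...   | inj₁ ℓy≤ℓx =
      subst (Walk Near x y) (cong (1 ⊔_) (sym (m≤n⇒∣n-m∣≡n∸m ℓy≤ℓx)))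
        (descend (ℓ x ∸ ℓ y) x y (sym (m∸n+n≡m ℓy≤ℓx)) x≢y)
    ...   | inj₂ ℓx≤ℓy =
      subst (Walk Near x y) (cong (1 ⊔_) (sym (trans (∣-∣-comm (ℓ x) (ℓ y)) (m≤n⇒∣n-m∣≡n∸m ℓx≤ℓy))))
        (reverseʷ (Graph.sym layered) (descend (ℓ y ∸ ℓ x) y x (sym (m∸n+n≡m ℓx≤ℓy)) (x≢y ∘ sym)))

    dist-isDistance : IsDistanceFunction layered dist
    dist-isDistance x y = dist-walk x y , λ _ → dist≤length

  -- The routes go from u to a, b and c directly, or to a directly and through b and through c.
  data EscapePattern (u : Fin n) (l : ℕ) : Set where
    three-below : ∀ {a b c} → a ≢ b → a ≢ c → b ≢ c →
                  ℓ a ≡ l → ℓ b ≡ l → ℓ c ≡ l → EscapePattern u l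
    one-below-two-beside : ∀ {a b c} → u ≢ b → u ≢ c → b ≢ c →
                           ℓ a ≡ l → ℓ b ≡ suc l → ℓ c ≡ suc l → EscapePattern u l

  pattern⇒three-escapes : ∀ {u l} → ℓ u ≡ suc l → EscapePattern u l → ThreeEscapes layered ℓ u l
  pattern⇒three-escapes {u} ℓu≡ (three-below {a} {b} {c} a≢b a≢c b≢c ℓa ℓb ℓc) = record
    { first      = escape (step (down ℓa) here) ℓa
    ; second     = escape (step (down ℓb) here) ℓb
    ; third      = escape (step (down ℓc) here) ℓc
    ; disjoint₁₂ = λ { (here refl) (here refl) → ≉ᵉ-by-target a≢b (lower⇒≢ ℓa ℓu≡) }
    ; disjoint₁₃ = λ { (here refl) (here refl) → ≉ᵉ-by-target a≢c (lower⇒≢ ℓa ℓu≡) }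
    ; disjoint₂₃ = λ { (here refl) (here refl) → ≉ᵉ-by-target b≢c (lower⇒≢ ℓb ℓu≡) }
    }
    where
    down : ∀ {x} → ℓ x ≡ _ → Near u x
    down ℓx = near-below (trans ℓu≡ (cong suc (sym ℓx)))
  pattern⇒three-escapes {u} ℓu≡ (one-below-two-beside {a} {b} {c} u≢b u≢c b≢c ℓa ℓb ℓc) = record
    { first      = escape (step (near-below (trans ℓu≡ (cong suc (sym ℓa)))) here) ℓa
    ; second     = escape (step (near-level u≢b (trans ℓu≡ (sym ℓb))) (step (aside ℓb) here)) ℓa
    ; third      = escape (step (near-level u≢c (trans ℓu≡ (sym ℓc))) (step (aside ℓc) here)) ℓa
    ; disjoint₁₂ = λ { (here refl) (here refl)         → ≉ᵉ-by-target (lower⇒≢ ℓa ℓb) a≢u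
                     ; (here refl) (there (here refl)) → ≉ᵉ-by-source u≢b (a≢u ∘ sym) }
    ; disjoint₁₃ = λ { (here refl) (here refl)         → ≉ᵉ-by-target (lower⇒≢ ℓa ℓc) a≢u
                     ; (here refl) (there (here refl)) → ≉ᵉ-by-source u≢c (a≢u ∘ sym) }
    ; disjoint₂₃ = λ { (here refl)         (here refl)         → ≉ᵉ-by-target b≢c (u≢b ∘ sym)
                     ; (here refl)         (there (here refl)) → ≉ᵉ-by-source u≢c (a≢u ∘ sym)
                     ; (there (here refl)) (here refl)         → ≉ᵉ-by-source (u≢b ∘ sym) b≢c
                     ; (there (here refl)) (there (here refl)) → ≉ᵉ-by-source b≢c (lower⇒≢ ℓa ℓb ∘ sym) }
    }
    where
    a≢u : a ≢ u
    a≢u = lower⇒≢ ℓa ℓu≡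
    aside : ∀ {x} → ℓ x ≡ suc _ → Near x a
    aside ℓx = near-below (trans ℓx (cong suc (sym ℓa)))

-- The extremal graph

-- Levels 0, 1, 1, 1, followed by the same pattern raised by two; the last n mod 4 vertices
-- share one level.
level : ∀ {n} → Fin n → ℕ
level {suc (suc (suc (suc _)))} zero                      = 0
level {suc (suc (suc (suc _)))} (suc zero)                = 1
level {suc (suc (suc (suc _)))} (suc (suc zero))          = 1
level {suc (suc (suc (suc _)))} (suc (suc (suc zero)))    = 1
level {suc (suc (suc (suc _)))} (suc (suc (suc (suc i)))) = 2 + level i
level _                                                   = 0

level-suc≥1 : ∀ {m} (j : Fin (3 + m)) → 1 ≤ level {4 + m} (suc j)
level-suc≥1 zero                = ≤-refl
level-suc≥1 (suc zero)          = ≤-refl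
level-suc≥1 (suc (suc zero))    = ≤-refl
level-suc≥1 (suc (suc (suc _))) = s≤s z≤n

level≡0⇒zero : ∀ {m} (u : Fin (4 + m)) → level u ≡ 0 → u ≡ zero
level≡0⇒zero zero    _  = refl
level≡0⇒zero (suc j) eq = ⊥-elim (<⇒≢ (level-suc≥1 j) (sym eq))

level-below : ∀ {n} (x : Fin n) k → k ≤ level x → ∃ λ (z : Fin n) → level z ≡ k
level-below {suc (suc (suc (suc _)))} _ zero       _ = zero , refl
level-below {suc (suc (suc (suc _)))} _ (suc zero) _ = suc zero , refl
level-below {suc (suc (suc (suc _)))} (suc (suc (suc (suc i)))) (suc (suc k)) (s≤s (s≤s k≤)) =
  let z , ℓz≡k = level-below i k k≤ in 4 ↑ʳ z , cong (2 +_) ℓz≡k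
level-below {suc (suc (suc (suc _)))} (suc zero)             (suc (suc _)) (s≤s ())
level-below {suc (suc (suc (suc _)))} (suc (suc zero))       (suc (suc _)) (s≤s ())
level-below {suc (suc (suc (suc _)))} (suc (suc (suc zero))) (suc (suc _)) (s≤s ())
level-below {1} x k k≤0 = x , sym (n≤0⇒n≡0 k≤0)
level-below {2} x k k≤0 = x , sym (n≤0⇒n≡0 k≤0)
level-below {3} x k k≤0 = x , sym (n≤0⇒n≡0 k≤0)

open LayeredGraph using (EscapePattern; three-below; one-below-two-beside)

raise-pattern : ∀ {m} {i : Fin m} {l} → EscapePattern level i l → EscapePattern level (4 ↑ʳ i) (2 + l)
raise-pattern (three-below a≢b a≢c b≢c ℓa ℓb ℓc) =
  three-below (a≢b ∘ ↑ʳ-injective 4 _ _) (a≢c ∘ ↑ʳ-injective 4 _ _) (b≢c ∘ ↑ʳ-injective 4 _ _)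
              (cong (2 +_) ℓa) (cong (2 +_) ℓb) (cong (2 +_) ℓc)
raise-pattern (one-below-two-beside {a} u≢b u≢c b≢c ℓa ℓb ℓc) =
  one-below-two-beside {a = 4 ↑ʳ a}
    (u≢b ∘ ↑ʳ-injective 4 _ _) (u≢c ∘ ↑ʳ-injective 4 _ _) (b≢c ∘ ↑ʳ-injective 4 _ _)
    (cong (2 +_) ℓa) (cong (2 +_) ℓb) (cong (2 +_) ℓc)

escape-pattern : ∀ {n} (u : Fin n) l → level u ≡ suc l → EscapePattern level u l
escape-pattern {suc (suc (suc (suc _)))} (suc zero) _ refl =
  one-below-two-beside {a = zero} {b = suc (suc zero)} {c = suc (suc (suc zero))}
    (λ ()) (λ ()) (λ ()) refl refl refl
escape-pattern {suc (suc (suc (suc _)))} (suc (suc zero)) _ refl =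
  one-below-two-beside {a = zero} {b = suc zero} {c = suc (suc (suc zero))}
    (λ ()) (λ ()) (λ ()) refl refl refl
escape-pattern {suc (suc (suc (suc _)))} (suc (suc (suc zero))) _ refl =
  one-below-two-beside {a = zero} {b = suc zero} {c = suc (suc zero)}
    (λ ()) (λ ()) (λ ()) refl refl refl
escape-pattern {suc (suc (suc (suc _)))} (suc (suc (suc (suc i)))) l ℓu≡ with level i in ℓi
escape-pattern {suc (suc (suc (suc _)))} (suc (suc (suc (suc i)))) _ refl | zero =
  three-below {a = suc zero} {b = suc (suc zero)} {c = suc (suc (suc zero))}
    (λ ()) (λ ()) (λ ()) refl refl refl
escape-pattern {suc (suc (suc (suc _)))} (suc (suc (suc (suc i)))) _ refl | suc l′ =
  raise-pattern (escape-pattern i l′ ℓi)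
escape-pattern {1} _ _ ()
escape-pattern {2} _ _ ()
escape-pattern {3} _ _ ()

sum-tabulate-2+ : ∀ m (f : Fin m → ℕ) → sum (tabulate (λ i → 2 + f i)) ≡ 2 * m + sum (tabulate f)
sum-tabulate-2+ zero    f = refl
sum-tabulate-2+ (suc m) f = begin
  2 + f zero + sum (tabulate (λ i → 2 + f (suc i)))  ≡⟨ cong (2 + f zero +_) (sum-tabulate-2+ m (f ∘ suc)) ⟩
  2 + f zero + (2 * m + sum (tabulate (f ∘ suc)))    ≡⟨ regroup (f zero) m (sum (tabulate (f ∘ suc))) ⟩
  2 * suc m + (f zero + sum (tabulate (f ∘ suc)))    ∎
  where
  open ≡-Reasoning
  regroup : ∀ x m s → 2 + x + (2 * m + s) ≡ 2 * suc m + (x + s)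
  regroup = solve-∀

sum-level : ∀ n → 4 * sum (tabulate (level {n})) + defect n ≡ n * (n ∸ 1)
sum-level 0 = refl
sum-level 1 = refl
sum-level 2 = refl
sum-level 3 = refl
sum-level (suc (suc (suc (suc m)))) = begin
  4 * (3 + sum (tabulate (λ i → 2 + level {m} i))) + defect (4 + m)
    ≡⟨ cong₂ (λ s c → 4 * (3 + s) + c) (sum-tabulate-2+ m (level {m})) (defect-4+ m) ⟩
  4 * (3 + (2 * m + sum (tabulate (level {m})))) + defect m
    ≡⟨ regroup m (sum (tabulate (level {m}))) (defect m) ⟩
  4 * (3 + m) + 4 * m + (4 * sum (tabulate (level {m})) + defect m)
    ≡⟨ cong (4 * (3 + m) + 4 * m +_) (sum-level m) ⟩
  4 * (3 + m) + 4 * m + m * (m ∸ 1)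
    ≡⟨ square-step m ⟨
  (4 + m) * (3 + m) ∎
  where
  open ≡-Reasoning
  regroup : ∀ m s c → 4 * (3 + (2 * m + s)) + c ≡ 4 * (3 + m) + 4 * m + (4 * s + c)
  regroup = solve-∀

module Extremal (m : ℕ) where

  open LayeredGraph (level {4 + m})

  three-edge-connected : EdgeConnected 3 layered
  three-edge-connected = three-escapes⇒3-edge-connected layered (level {4 + m}) zero level≡0⇒zero
    (λ u l ℓu≡ → pattern⇒three-escapes ℓu≡ (escape-pattern u l ℓu≡))

  isDistance : IsDistanceFunction layered dist
  isDistance = dist-isDistance level-below

  dist-from-zero : ∀ y → dist zero y ≡ level y
  dist-from-zero zero    = refl
  dist-from-zero (suc j) = m≤n⇒m⊔n≡n (level-suc≥1 j)

  transmission-zero : 4 * transmission dist zero + defect (4 + m) ≡ (4 + m) * (3 + m)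
  transmission-zero = trans (cong (λ σ → 4 * σ + defect (4 + m)) σ₀≡) (sum-level (4 + m))
    where
    σ₀≡ : transmission dist zero ≡ sum (tabulate (level {4 + m}))
    σ₀≡ = trans (cong sum (map-tabulate id (dist zero))) (cong sum (tabulate-cong dist-from-zero))

  -- The upper bound, applied to this graph itself, leaves no room above vertex zero.
  maxTransmission-extremal : 4 * maxTransmission dist + defect (4 + m) ≡ (4 + m) * (3 + m)
  maxTransmission-extremal = ≤-antisym (maxTransmission-bound layered three-edge-connected isDistance)
    (≤-trans (≤-reflexive (sym transmission-zero))
             (+-monoˡ-≤ (defect (4 + m)) (*-monoʳ-≤ 4 (transmission≤max dist zero))))

mainTheorem7 : ((n : ℕ) → 2 ≤ n → (G : Graph n) → EdgeConnected 3 G →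
                  (D : DistFn n) → IsDistanceFunction G D →
                  remoteness D ≤ℚ remotenessBound n)
               × ((n : ℕ) → 4 ≤ n → Σ (Graph n) λ G → EdgeConnected 3 G ×
                  Σ (DistFn n) λ D → IsDistanceFunction G D ×
                  remoteness D ≃ℚ remotenessBound n)
mainTheorem7 = upper-bound , sharpness
  where
  upper-bound : (n : ℕ) → 2 ≤ n → (G : Graph n) → EdgeConnected 3 G →
                (D : DistFn n) → IsDistanceFunction G D → remoteness D ≤ℚ remotenessBound n
  upper-bound n 2≤n G ec D isDist =
    remoteness≤bound n (maxTransmission D) 2≤n (maxTransmission-bound G ec isDist)

  sharpness : (n : ℕ) → 4 ≤ n → Σ (Graph n) λ G → EdgeConnected 3 G ×
              Σ (DistFn n) λ D → IsDistanceFunction G D × remoteness D ≃ℚ remotenessBound n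
  sharpness _ (s≤s (s≤s (s≤s (s≤s (z≤n {m}))))) =
    layered , three-edge-connected , dist , isDistance ,
    remoteness≃bound (4 + m) (maxTransmission dist) (s≤s (s≤s z≤n)) maxTransmission-extremal
    where
    open Extremal m
    open LayeredGraph (level {4 + m})
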